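{- Let $n\ge 5$ be odd and not divisible by $3$, let $G=\Gamma(\mathbb{Z}_n,\{1,2\cdot 3^{ -1}\})$, and let $H=\Gamma(\mathbb{Z}_n,\{a,b\})$ be any directed circulant graph with a two-element generating set $\{a,b\}$. Then $F_2(G)\ge F_2(H)$.
   Context: $3^{ -1}$ denotes the multiplicative inverse of $3$ modulo $n$. For a generating set $S$ of $(\mathbb{Z}_n,+)$ with $0\notin S$, $\Gamma(\mathbb{Z}_n,S)$ has vertices $v_0,\dots,v_{n-1}$ and an arc $v_j\to v_i$ iff $i-j\pmod n\in S$. For a digraph $D$ on $n$ vertices and $0\le i\le n-1$, $F_i(D)$ is the number of $i$-element vertex subsets $X$ such that the subdigraph induced by $V(D)\setminus X$ is strongly connected (a single vertex counts as strongly connected); these are the coefficients in $\mathrm{Rel}(D,p)=\sum_{i=0}^{n-1}F_i(D)p^{n-i}(1-p)^i$. -}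

module Defs where

open import Data.Nat using (ℕ; zero; suc; _+_; _*_; _∸_; _≤ᵇ_; _<_; _≤_)
open import Data.Integer as ℤ using (ℤ; +_)
open import Data.Integer.Divisibility using () renaming (_∣_ to _∣ℤ_)
open import Data.Fin using (Fin; toℕ)
open import Data.Fin.Subset using (Subset; _∈_; ∁; ∣_∣)
open import Data.Bool using (if_then_else_)
open import Data.Sum using (_⊎_)
open import Data.Product using (_×_; ∃-syntax)
open import Data.List using (List; length)
open import Data.List.Membership.Propositional renaming (_∈_ to _∈L_)
open import Data.List.Relation.Unary.Unique.Propositional using (Unique)
open import Relation.Binary.PropositionalEquality using (_≡_)
open import Function.Bundles using (_⇔_)

Digraph : ℕ → Set₁
Digraph n = Fin n → Fin n → Set

diffMod : (n : ℕ) → Fin n → Fin n → ℕ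
diffMod n i j = if toℕ j ≤ᵇ toℕ i then toℕ i ∸ toℕ j else (n + toℕ i) ∸ toℕ j

Circulant : (n a b : ℕ) → Digraph n
Circulant n a b j i = diffMod n i j ≡ a ⊎ diffMod n i j ≡ b

Generates : (n a b : ℕ) → Set
Generates n a b = ∀ (k : Fin n) → ∃[ x ] ∃[ y ]
  ((+ n) ∣ℤ ((x ℤ.* + a ℤ.+ y ℤ.* + b) ℤ.- + toℕ k))

data PathIn {n : ℕ} (D : Digraph n) (W : Subset n) : Fin n → Fin n → Set where
  here  : ∀ {u} → u ∈ W → PathIn D W u u
  step  : ∀ {u w v} → u ∈ W → D u w → PathIn D W w v → PathIn D W u v

StronglyConnected : {n : ℕ} → Digraph n → Subset n → Set
StronglyConnected D W = ∀ u v → u ∈ W → v ∈ W → PathIn D W u v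

Good : {n : ℕ} → Digraph n → ℕ → Subset n → Set
Good D i X = (∣ X ∣ ≡ i) × StronglyConnected D (∁ X)

-- IsF D i k : F_i(D) = k, i.e. the number of subsets X with Good D i X is k
-- (witnessed by a duplicate-free list enumerating exactly those subsets).
IsF : {n : ℕ} → Digraph n → ℕ → ℕ → Set
IsF {n} D i k = ∃[ L ] (Unique L × (∀ (X : Subset n) → (X ∈L L) ⇔ Good D i X) × (length L ≡ k))

{-# OPTIONS --safe #-}
-- In H, deleting the two out-neighbours v + a, v + b of a vertex v leaves v a sink, so these n
-- two-sets, pairwise distinct because 2 is invertible modulo the odd n, never count for F₂(H).
-- In G, label the vertex t · 3⁻¹ by t ∈ ℕ; the arcs become t → t + 2 and t → t + 3. A two-set X
-- other than the n pairs {t, t + 1} blocks no two consecutive labels and not all of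
-- s + 2, s + 5, s + 8, so walking forward in steps of 2 and 3 around X reaches every free label
-- from every free label: G − X is strongly connected. Thus F₂(H) + n ≤ #two-sets ≤ F₂(G) + n.
module Submission where

open import Defs
open import Data.Nat using (ℕ; _+_; _*_; _<_; _≤_)
open import Data.Nat.Divisibility using (_∣_)
open import Data.Product using (∃-syntax)
open import Relation.Nullary using (¬_)
open import Relation.Binary.PropositionalEquality using (_≡_; _≢_)

open import Data.Nat.Base
  using (zero; suc; _∸_; _≤ᵇ_; z≤n; s≤s; NonZero; >-nonZero; >-nonZero⁻¹)
open import Data.Nat.Properties
open import Data.Nat.DivMod using (_%_; _/_; _mod_; m%n<n; m%n%n≡m%n; [m+n]%n≡m%n; [m+kn]%n≡m%n;
  m<n⇒m%n≡m; %-distribˡ-+; %-distribˡ-*; m≡m%n+[m/n]*n)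
open import Data.Nat.Divisibility using (divides; m%n≡0⇒n∣m; ∣⇒≤; ∣1⇒≡1)
open import Data.Nat.Tactic.RingSolver using (solve-∀)
open import Data.Bool.Base using (true; false; T)
open import Data.Unit.Base using (tt)
open import Data.Empty using (⊥)
open import Data.Fin.Base as Fin using (Fin; toℕ)
open import Data.Fin.Properties using (toℕ-fromℕ<; toℕ-injective; toℕ<n; any?)
open import Data.Fin.Subset using (Subset; _∈_; _∉_; _⊆_; ∁; ∣_∣; ⁅_⁆; _∪_)
open import Data.Fin.Subset.Properties using (_∈?_; x∈p∪q⁻; x∈p∪q⁺; x∈⁅x⁆; x∈⁅y⁆⇒x≡y;
  ∣⁅x⁆∣≡1; ⊆-antisym; p⊆q⇒∣p∣≤∣q∣; p⊂q⇒∣p∣<∣q∣; x∉p⇒x∈∁p; x∈∁p⇒x∉p; ∣∁p∣≡n∸∣p∣;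
  ∪-identityˡ; ∪-identityʳ)
open import Data.Product using (_×_; _,_; -,_; proj₁; proj₂)
open import Data.Sum using (_⊎_; inj₁; inj₂)
open import Data.List.Base using (List; []; _∷_; _++_; length; map; allFin)
open import Data.List.Properties using (length-++; length-++-sucʳ; length-map; length-tabulate)
open import Data.List.Relation.Unary.Any using (here; there)
import Data.List.Relation.Unary.All as All
open import Data.List.Relation.Unary.AllPairs using (_∷_)
open import Data.List.Membership.Propositional using () renaming (_∈_ to _∈ₗ_)
open import Data.List.Membership.Propositional.Properties using (∈-∃++; ∈-++⁻; ∈-++⁺ˡ; ∈-++⁺ʳ;
  ∈-map⁺; ∈-map⁻; ∈-allFin)
open import Data.List.Relation.Unary.Unique.Propositional using (Unique)
open import Data.List.Relation.Unary.Unique.Propositional.Properties using (map⁺; ++⁺; allFin⁺)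
open import Function.Base using (_∘_)
open import Function.Bundles using (Equivalence)
open import Relation.Nullary using (yes; no; contradiction)
open import Relation.Nullary.Decidable using (_×-dec_)
open import Relation.Unary using (Decidable)
open import Relation.Binary.PropositionalEquality
  using (refl; sym; trans; cong; cong₂; subst; module ≡-Reasoning)

unique-⊆⇒length≤ : {A : Set} {xs ys : List A} → Unique xs → (∀ {z} → z ∈ₗ xs → z ∈ₗ ys) →
                   length xs ≤ length ys
unique-⊆⇒length≤ {xs = []} _ _ = z≤n
unique-⊆⇒length≤ {xs = x ∷ xs} (x∉xs ∷ xs!) xs⊆ys
  with as , bs , refl ← ∈-∃++ (xs⊆ys (here refl)) =
  subst (suc (length xs) ≤_) (sym (length-++-sucʳ as x bs)) (s≤s (unique-⊆⇒length≤ xs! xs⊆as++bs))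
  where
  xs⊆as++bs : ∀ {z} → z ∈ₗ xs → z ∈ₗ as ++ bs
  xs⊆as++bs z∈xs with ∈-++⁻ as (xs⊆ys (there z∈xs))
  ... | inj₁ z∈as         = ∈-++⁺ˡ z∈as
  ... | inj₂ (here refl)  = contradiction refl (All.lookup x∉xs z∈xs)
  ... | inj₂ (there z∈bs) = ∈-++⁺ʳ as z∈bs

length-map-allFin : {A : Set} {n : ℕ} (f : Fin n → A) → length (map f (allFin n)) ≡ n
length-map-allFin {n = n} f = trans (length-map f (allFin n)) (length-tabulate (λ i → i))

-- F_i(E) + |S| ≤ (number of i-sets) ≤ F_i(D) + |T|.
IsF-≤ : ∀ {n} {D E : Digraph n} {i kD kE} (S T : List (Subset n)) →
        IsF D i kD → IsF E i kE → Unique S →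
        (∀ {X} → X ∈ₗ S → ∣ X ∣ ≡ i × ¬ StronglyConnected E (∁ X)) →
        (∀ X → ∣ X ∣ ≡ i → Good D i X ⊎ X ∈ₗ T) →
        length T ≤ length S → kE ≤ kD
IsF-≤ {i = i} S T (LD , _ , LD↔ , refl) (LE , LE! , LE↔ , refl) S! S-bad D-covers ∣T∣≤∣S∣ =
  +-cancelʳ-≤ (length S) (length LE) (length LD) (begin
    length LE + length S   ≡⟨ length-++ LE ⟨
    length (LE ++ S)       ≤⟨ unique-⊆⇒length≤ (++⁺ LE! S! disjoint) LE++S⊆LD++T ⟩
    length (LD ++ T)       ≡⟨ length-++ LD ⟩
    length LD + length T   ≤⟨ +-monoʳ-≤ (length LD) ∣T∣≤∣S∣ ⟩
    length LD + length S   ∎)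
  where
  open ≤-Reasoning

  disjoint : ∀ {X} → ¬ (X ∈ₗ LE × X ∈ₗ S)
  disjoint {X} (X∈LE , X∈S) = proj₂ (S-bad X∈S) (proj₂ (Equivalence.to (LE↔ X) X∈LE))

  i-set⇒∈LD++T : ∀ {X} → ∣ X ∣ ≡ i → X ∈ₗ LD ++ T
  i-set⇒∈LD++T {X} ∣X∣≡i with D-covers X ∣X∣≡i
  ... | inj₁ good = ∈-++⁺ˡ (Equivalence.from (LD↔ X) good)
  ... | inj₂ X∈T  = ∈-++⁺ʳ LD X∈T

  LE++S⊆LD++T : ∀ {X} → X ∈ₗ LE ++ S → X ∈ₗ LD ++ T
  LE++S⊆LD++T {X} X∈ with ∈-++⁻ LE X∈
  ... | inj₁ X∈LE = i-set⇒∈LD++T (proj₁ (Equivalence.to (LE↔ X) X∈LE))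
  ... | inj₂ X∈S  = i-set⇒∈LD++T (proj₁ (S-bad X∈S))

module _ {n : ℕ} where

  pair : Fin n → Fin n → Subset n
  pair x y = ⁅ x ⁆ ∪ ⁅ y ⁆

  x∈pair : ∀ x y → x ∈ pair x y
  x∈pair x y = x∈p∪q⁺ (inj₁ (x∈⁅x⁆ x))

  y∈pair : ∀ x y → y ∈ pair x y
  y∈pair x y = x∈p∪q⁺ (inj₂ (x∈⁅x⁆ y))

  ∈pair⁻ : ∀ {x y z} → z ∈ pair x y → z ≡ x ⊎ z ≡ y
  ∈pair⁻ {x} {y} z∈pair with x∈p∪q⁻ ⁅ x ⁆ ⁅ y ⁆ z∈pair
  ... | inj₁ z∈⁅x⁆ = inj₁ (x∈⁅y⁆⇒x≡y x z∈⁅x⁆)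
  ... | inj₂ z∈⁅y⁆ = inj₂ (x∈⁅y⁆⇒x≡y y z∈⁅y⁆)

∣pair∣≡2 : ∀ {n} {x y : Fin n} → x ≢ y → ∣ pair x y ∣ ≡ 2
∣pair∣≡2 {x = Fin.zero}  {Fin.zero}  x≢y = contradiction refl x≢y
∣pair∣≡2 {x = Fin.zero}  {Fin.suc y} _   = cong suc (trans (cong ∣_∣ (∪-identityˡ ⁅ y ⁆)) (∣⁅x⁆∣≡1 y))
∣pair∣≡2 {x = Fin.suc x} {Fin.zero}  _   = cong suc (trans (cong ∣_∣ (∪-identityʳ ⁅ x ⁆)) (∣⁅x⁆∣≡1 x))
∣pair∣≡2 {x = Fin.suc x} {Fin.suc y} x≢y = ∣pair∣≡2 (x≢y ∘ cong Fin.suc)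

module _ {n : ℕ} {p : Subset n} (∣p∣≡2 : ∣ p ∣ ≡ 2) where

  ∣p∣≡2⇒p≡pair : ∀ {x y} → x ≢ y → x ∈ p → y ∈ p → p ≡ pair x y
  ∣p∣≡2⇒p≡pair {x} {y} x≢y x∈p y∈p = ⊆-antisym p⊆pair pair⊆p
    where
    pair⊆p : pair x y ⊆ p
    pair⊆p z∈pair with ∈pair⁻ z∈pair
    ... | inj₁ refl = x∈p
    ... | inj₂ refl = y∈p

    p⊆pair : p ⊆ pair x y
    p⊆pair {z} z∈p with z ∈? pair x y
    ... | yes z∈pair = z∈pair
    ... | no  z∉pair = contradiction (p⊂q⇒∣p∣<∣q∣ (pair⊆p , z , z∈p , z∉pair))
                                     (<-irrefl (trans (∣pair∣≡2 x≢y) (sym ∣p∣≡2)))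

  ∣p∣≡2⇒¬three : ∀ {x y z} → x ≢ y → y ≢ z → x ≢ z → x ∈ p → y ∈ p → z ∈ p → ⊥
  ∣p∣≡2⇒¬three x≢y y≢z x≢z x∈p y∈p z∈p
    with ∈pair⁻ (subst (_ ∈_) (∣p∣≡2⇒p≡pair x≢y x∈p y∈p) z∈p)
  ... | inj₁ z≡x = x≢z (sym z≡x)
  ... | inj₂ z≡y = y≢z (sym z≡y)

module _ {n : ℕ} {D : Digraph n} {W : Subset n} where

  pathIn-source∈ : ∀ {u v} → PathIn D W u v → u ∈ W
  pathIn-source∈ (here u∈W)     = u∈W
  pathIn-source∈ (step u∈W _ _) = u∈W

  pathIn-snoc : ∀ {u v w} → PathIn D W u v → D v w → w ∈ W → PathIn D W u w
  pathIn-snoc (here v∈W)         v→w w∈W = step v∈W v→w (here w∈W)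
  pathIn-snoc (step u∈W u→x x⇝v) v→w w∈W = step u∈W u→x (pathIn-snoc x⇝v v→w w∈W)

module ForwardWalks (Blocked : ℕ → Set) (blocked? : Decidable Blocked)
                    (isolated : ∀ t → Blocked t → ¬ Blocked (suc t))
                    (Reached : ℕ → Set)
                    (reach+2 : ∀ {t} → Reached t → ¬ Blocked (2 + t) → Reached (2 + t))
                    (reach+3 : ∀ {t} → Reached t → ¬ Blocked (3 + t) → Reached (3 + t)) where

  Covered : ℕ → Set
  Covered t = ¬ Blocked t → Reached t

  Window : ℕ → Set
  Window t = Covered t × Covered (1 + t) × Covered (2 + t)

  -- A free position t + 3 is entered from t + 1, or, if t + 1 is blocked, from t.
  window-suc : ∀ {t} → Window t → Window (suc t)
  window-suc {t} (covered₀ , covered₁ , covered₂) = covered₁ , covered₂ , covered₃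
    where
    covered₃ : Covered (3 + t)
    covered₃ free₃ with blocked? (1 + t)
    ... | yes blocked₁ = reach+3 (covered₀ (λ blocked₀ → isolated t blocked₀ blocked₁)) free₃
    ... | no  free₁    = reach+2 (covered₁ free₁) free₃

  window⇒covered : ∀ {q} → Window q → ∀ t → q ≤ t → Covered t
  window⇒covered {q} window t q≤t = subst Covered (m∸n+n≡m q≤t) (proj₁ (window-+ (t ∸ q)))
    where
    window-+ : ∀ d → Window (d + q)
    window-+ zero    = window
    window-+ (suc d) = window-suc (window-+ d)

  window-or-blocked : ∀ {t} → Reached t → Window (2 + t) ⊎ (Blocked (2 + t) × Reached (3 + t))
  window-or-blocked {t} reached with blocked? (2 + t)
  ... | yes blocked₂ = inj₂ (blocked₂ , reach+3 reached (isolated (2 + t) blocked₂))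
  ... | no  free₂    = inj₁ ((λ _ → reached₂) , reach+3 reached , reach+2 reached₂)
    where reached₂ = reach+2 reached free₂

  eventually-covered : ∀ {s} → Reached s →
                       ¬ (Blocked (2 + s) × Blocked (5 + s) × Blocked (8 + s)) →
                       ∃[ q ] (∀ t → q ≤ t → Covered t)
  eventually-covered reached not-all with window-or-blocked reached
  ... | inj₁ window = -, window⇒covered window
  ... | inj₂ (blocked₂ , reached₃) with window-or-blocked reached₃
  ...   | inj₁ window = -, window⇒covered window
  ...   | inj₂ (blocked₅ , reached₆) with window-or-blocked reached₆
  ...     | inj₁ window = -, window⇒covered window
  ...     | inj₂ (blocked₈ , _) = contradiction (blocked₂ , blocked₅ , blocked₈) not-all

odd⇒≡1+[n/2]*2 : ∀ n → ¬ 2 ∣ n → n ≡ 1 + n / 2 * 2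
odd⇒≡1+[n/2]*2 n 2∤n with n % 2 in n%2≡r | m%n<n n 2
... | 0 | _ = contradiction (m%n≡0⇒n∣m n 2 n%2≡r) 2∤n
... | 1 | _ = trans (m≡m%n+[m/n]*n n 2) (cong (_+ n / 2 * 2) n%2≡r)
... | suc (suc _) | s≤s (s≤s ())

odd⇒∤6 : ∀ {n} → 5 ≤ n → ¬ 2 ∣ n → ¬ n ∣ 6
odd⇒∤6 {0} ()
odd⇒∤6 {1} (s≤s ())
odd⇒∤6 {2} (s≤s (s≤s ()))
odd⇒∤6 {3} (s≤s (s≤s (s≤s ())))
odd⇒∤6 {4} (s≤s (s≤s (s≤s (s≤s ()))))
odd⇒∤6 {5} _ _ (divides (suc (suc _)) ())
odd⇒∤6 {6} _ 2∤n _ = 2∤n (divides 3 refl)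
odd⇒∤6 {suc (suc (suc (suc (suc (suc (suc _))))))} _ _ n∣6 with ∣⇒≤ n∣6
... | s≤s (s≤s (s≤s (s≤s (s≤s (s≤s ())))))

infix 4 _≈_[mod_]
_≈_[mod_] : ℕ → ℕ → (n : ℕ) → .{{NonZero n}} → Set
a ≈ b [mod n ] = a % n ≡ b % n

module Residues (n : ℕ) .{{_ : NonZero n}} where
  open ≡-Reasoning

  ≈-+ : ∀ {a b c d} → a ≈ b [mod n ] → c ≈ d [mod n ] → a + c ≈ b + d [mod n ]
  ≈-+ {a} {b} {c} {d} a≈b c≈d = begin
    (a + c) % n          ≡⟨ %-distribˡ-+ a c n ⟩
    (a % n + c % n) % n  ≡⟨ cong₂ (λ x y → (x + y) % n) a≈b c≈d ⟩
    (b % n + d % n) % n  ≡⟨ %-distribˡ-+ b d n ⟨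
    (b + d) % n          ∎

  ≈-* : ∀ {a b c d} → a ≈ b [mod n ] → c ≈ d [mod n ] → a * c ≈ b * d [mod n ]
  ≈-* {a} {b} {c} {d} a≈b c≈d = begin
    (a * c) % n          ≡⟨ %-distribˡ-* a c n ⟩
    (a % n * (c % n)) % n  ≡⟨ cong₂ (λ x y → (x * y) % n) a≈b c≈d ⟩
    (b % n * (d % n)) % n  ≡⟨ %-distribˡ-* b d n ⟨
    (b * d) % n          ∎

  m+kn≈m : ∀ m k → m + k * n ≈ m [mod n ]
  m+kn≈m m k = [m+kn]%n≡m%n m k n

  m%n≈m : ∀ m → m % n ≈ m [mod n ]
  m%n≈m m = m%n%n≡m%n m n

  ≈⇒≡ : ∀ {a b} → a < n → b < n → a ≈ b [mod n ] → a ≡ b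
  ≈⇒≡ a<n b<n a≈b = trans (sym (m<n⇒m%n≡m a<n)) (trans a≈b (m<n⇒m%n≡m b<n))

  -- Adding k · (n ∸ 1) undoes adding k.
  ≈-cancelʳ-+ : ∀ {a b} k → a + k ≈ b + k [mod n ] → a ≈ b [mod n ]
  ≈-cancelʳ-+ {a} {b} k a+k≈b+k = begin
    a % n                     ≡⟨ m+kn≈m a k ⟨
    (a + k * n) % n           ≡⟨ cong (_% n) (unfold a) ⟩
    (a + k + k * pred n) % n  ≡⟨ ≈-+ {c = k * pred n} a+k≈b+k refl ⟩
    (b + k + k * pred n) % n  ≡⟨ cong (_% n) (unfold b) ⟨
    (b + k * n) % n           ≡⟨ m+kn≈m b k ⟩
    b % n                     ∎
    where
    pred = _∸ 1
    unfold : ∀ x → x + k * n ≡ x + k + k * pred n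
    unfold x = begin
      x + k * n                ≡⟨ cong (λ m → x + k * m) (suc-pred n) ⟨
      x + k * suc (pred n)     ≡⟨ cong (x +_) (*-suc k (pred n)) ⟩
      x + (k + k * pred n)     ≡⟨ +-assoc x k (k * pred n) ⟨
      x + k + k * pred n       ∎

  ≈-cancelʳ-* : ∀ {u w} a b → w * u ≈ 1 [mod n ] → a * u ≈ b * u [mod n ] → a ≈ b [mod n ]
  ≈-cancelʳ-* {u} {w} a b wu≈1 au≈bu = begin
    a % n          ≡⟨ undo a ⟨
    (a * u * w) % n  ≡⟨ ≈-* {c = w} au≈bu refl ⟩
    (b * u * w) % n  ≡⟨ undo b ⟩
    b % n          ∎
    where
    undo : ∀ x → x * u * w ≈ x [mod n ]
    undo x = begin
      (x * u * w) % n    ≡⟨ cong (_% n) (trans (*-assoc x u w) (cong (x *_) (*-comm u w))) ⟩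
      (x * (w * u)) % n  ≡⟨ ≈-* {a = x} refl wu≈1 ⟩
      (x * 1) % n        ≡⟨ cong (_% n) (*-identityʳ x) ⟩
      x % n              ∎

  toℕ-mod : ∀ a → toℕ (a mod n) ≡ a % n
  toℕ-mod a = toℕ-fromℕ< (m%n<n a n)

  toℕ-mod≈ : ∀ a → toℕ (a mod n) ≈ a [mod n ]
  toℕ-mod≈ a = trans (cong (_% n) (toℕ-mod a)) (m%n≈m a)

  mod-cong : ∀ {a b} → a ≈ b [mod n ] → a mod n ≡ b mod n
  mod-cong {a} {b} a≈b = toℕ-injective (trans (toℕ-mod a) (trans a≈b (sym (toℕ-mod b))))

  mod-injective : ∀ {a b} → a mod n ≡ b mod n → a ≈ b [mod n ]
  mod-injective {a} {b} eq = trans (sym (toℕ-mod a)) (trans (cong toℕ eq) (toℕ-mod b))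

  toℕ-mod-inverse : ∀ (u : Fin n) → toℕ u mod n ≡ u
  toℕ-mod-inverse u = toℕ-injective (trans (toℕ-mod (toℕ u)) (m<n⇒m%n≡m (toℕ<n u)))

  toℕ-≈-injective : ∀ {u v : Fin n} → toℕ u ≈ toℕ v [mod n ] → u ≡ v
  toℕ-≈-injective u≈v = toℕ-injective (≈⇒≡ (toℕ<n _) (toℕ<n _) u≈v)

  infixl 6 _⊕_
  _⊕_ : Fin n → ℕ → Fin n
  v ⊕ k = (toℕ v + k) mod n

  mod-⊕ : ∀ a k → a mod n ⊕ k ≡ (a + k) mod n
  mod-⊕ a k = mod-cong (≈-+ {c = k} (toℕ-mod≈ a) refl)

  ⊕-cong : ∀ v {k l} → k ≈ l [mod n ] → v ⊕ k ≡ v ⊕ l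
  ⊕-cong v k≈l = mod-cong (≈-+ {a = toℕ v} refl k≈l)

  ⊕-identityʳ : ∀ v → v ⊕ 0 ≡ v
  ⊕-identityʳ v = trans (cong (_mod n) (+-identityʳ (toℕ v))) (toℕ-mod-inverse v)

  ⊕-cancelˡ : ∀ v {k l} → k < n → l < n → v ⊕ k ≡ v ⊕ l → k ≡ l
  ⊕-cancelˡ v {k} {l} k<n l<n eq = ≈⇒≡ k<n l<n (≈-cancelʳ-+ (toℕ v) (begin
    (k + toℕ v) % n  ≡⟨ cong (_% n) (+-comm k (toℕ v)) ⟩
    (toℕ v + k) % n  ≡⟨ mod-injective eq ⟩
    (toℕ v + l) % n  ≡⟨ cong (_% n) (+-comm (toℕ v) l) ⟩
    (l + toℕ v) % n  ∎))

  ⊕-cancelʳ : ∀ {v w} k → v ⊕ k ≡ w ⊕ k → v ≡ w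
  ⊕-cancelʳ k eq = toℕ-≈-injective (≈-cancelʳ-+ k (mod-injective eq))

  private
    ≤ᵇ≡true⇒≤ : ∀ {i j} → (i ≤ᵇ j) ≡ true → i ≤ j
    ≤ᵇ≡true⇒≤ {i} {j} eq = ≤ᵇ⇒≤ i j (subst T (sym eq) tt)

    ≤ᵇ≡false⇒> : ∀ {i j} → (i ≤ᵇ j) ≡ false → j < i
    ≤ᵇ≡false⇒> eq = ≰⇒> (λ i≤j → subst T eq (≤⇒≤ᵇ i≤j))

  diffMod<n : ∀ w v → diffMod n w v < n
  diffMod<n w v with toℕ v ≤ᵇ toℕ w in v≤ᵇw
  ... | true  = ≤-<-trans (m∸n≤m (toℕ w) (toℕ v)) (toℕ<n w)
  ... | false = m<n+o⇒m∸n<o (n + toℕ w) (toℕ v)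
                  (subst (n + toℕ w <_) (+-comm n (toℕ v)) (+-monoʳ-< n (≤ᵇ≡false⇒> v≤ᵇw)))

  ⊕-diffMod : ∀ w v → v ⊕ diffMod n w v ≡ w
  ⊕-diffMod w v = trans (mod-cong (v+diff≈w)) (toℕ-mod-inverse w)
    where
    v+diff≈w : toℕ v + diffMod n w v ≈ toℕ w [mod n ]
    v+diff≈w with toℕ v ≤ᵇ toℕ w in v≤ᵇw
    ... | true  = cong (_% n) (m+[n∸m]≡n (≤ᵇ≡true⇒≤ {toℕ v} v≤ᵇw))
    ... | false = begin
      (toℕ v + (n + toℕ w ∸ toℕ v)) % n  ≡⟨ cong (_% n) (m+[n∸m]≡n v≤n+w) ⟩
      (n + toℕ w) % n                    ≡⟨ cong (_% n) (+-comm n (toℕ w)) ⟩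
      (toℕ w + n) % n                    ≡⟨ [m+n]%n≡m%n (toℕ w) n ⟩
      toℕ w % n                          ∎
      where v≤n+w = ≤-trans (<⇒≤ (toℕ<n v)) (m≤m+n n (toℕ w))

  diffMod-⊕ : ∀ v {d} → d < n → diffMod n (v ⊕ d) v ≡ d
  diffMod-⊕ v {d} d<n = ⊕-cancelˡ v (diffMod<n (v ⊕ d) v) d<n (⊕-diffMod (v ⊕ d) v)

  diffMod≡⇒≡⊕ : ∀ {w v d} → diffMod n w v ≡ d → w ≡ v ⊕ d
  diffMod≡⇒≡⊕ {w} {v} refl = sym (⊕-diffMod w v)

  odd⇒[1+n/2]*2≈1 : ¬ 2 ∣ n → (1 + n / 2) * 2 ≈ 1 [mod n ]
  odd⇒[1+n/2]*2≈1 2∤n = begin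
    ((1 + n / 2) * 2) % n  ≡⟨ cong (λ m → suc m % n) (odd⇒≡1+[n/2]*2 n 2∤n) ⟨
    (1 + n) % n            ≡⟨ [m+n]%n≡m%n 1 n ⟩
    1 % n                  ∎

  3*[c*w]≈1 : ∀ {c w} → 3 * c ≈ 2 [mod n ] → w * 2 ≈ 1 [mod n ] → 3 * (c * w) ≈ 1 [mod n ]
  3*[c*w]≈1 {c} {w} 3c≈2 w2≈1 = begin
    (3 * (c * w)) % n  ≡⟨ cong (_% n) (*-assoc 3 c w) ⟨
    (3 * c * w) % n    ≡⟨ ≈-* {c = w} 3c≈2 refl ⟩
    (2 * w) % n        ≡⟨ cong (_% n) (*-comm 2 w) ⟩
    (w * 2) % n        ≡⟨ w2≈1 ⟩
    1 % n              ∎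

  2*[c*w]≈c : ∀ {w} c → w * 2 ≈ 1 [mod n ] → 2 * (c * w) ≈ c [mod n ]
  2*[c*w]≈c {w} c w2≈1 = begin
    (2 * (c * w)) % n  ≡⟨ cong (_% n) (reassociate c w) ⟩
    (c * (w * 2)) % n  ≡⟨ ≈-* {a = c} refl w2≈1 ⟩
    (c * 1) % n        ≡⟨ cong (_% n) (*-identityʳ c) ⟩
    c % n              ∎
    where
    reassociate : ∀ c w → 2 * (c * w) ≡ c * (w * 2)
    reassociate = solve-∀

module Relabelled (n : ℕ) .{{_ : NonZero n}} (c e : ℕ) (1<n : 1 < n) (c<n : c < n)
                  (3*e≈1 : 3 * e ≈ 1 [mod n ]) (2*e≈c : 2 * e ≈ c [mod n ])
                  (n∤3 : ¬ n ∣ 3) (n∤6 : ¬ n ∣ 6) where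
  open Residues n

  G : Digraph n
  G = Circulant n 1 c

  V : ℕ → Fin n
  V t = (t * e) mod n

  V-cong : ∀ {t t′} → t ≈ t′ [mod n ] → V t ≡ V t′
  V-cong t≈t′ = mod-cong (≈-* {c = e} t≈t′ refl)

  V-injective : ∀ {t t′} → V t ≡ V t′ → t ≈ t′ [mod n ]
  V-injective {t} {t′} eq = ≈-cancelʳ-* {e} {3} t t′ 3*e≈1 (mod-injective eq)

  V-distinct : ∀ k t → ¬ n ∣ k → V t ≢ V (k + t)
  V-distinct k t n∤k eq = n∤k (m%n≡0⇒n∣m k n (begin
    k % n  ≡⟨ ≈-cancelʳ-+ {0} {k} t (V-injective eq) ⟨
    0 % n  ≡⟨ m<n⇒m%n≡m (>-nonZero⁻¹ n) ⟩
    0      ∎))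
    where open ≡-Reasoning

  V-periodic : ∀ t k → V (t + k * n) ≡ V t
  V-periodic t k = V-cong (m+kn≈m t k)

  V-3* : ∀ (u : Fin n) → V (3 * toℕ u) ≡ u
  V-3* u = begin
    V (3 * toℕ u)            ≡⟨ cong (_mod n) (reassociate (toℕ u) e) ⟩
    (toℕ u * (3 * e)) mod n  ≡⟨ mod-cong (≈-* {a = toℕ u} refl 3*e≈1) ⟩
    (toℕ u * 1) mod n        ≡⟨ cong (_mod n) (*-identityʳ (toℕ u)) ⟩
    toℕ u mod n              ≡⟨ toℕ-mod-inverse u ⟩
    u                        ∎
    where
    open ≡-Reasoning
    reassociate : ∀ u e → 3 * u * e ≡ u * (3 * e)
    reassociate = solve-∀

  V-step : ∀ k {d} t → k * e ≈ d [mod n ] → V (k + t) ≡ V t ⊕ d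
  V-step k {d} t ke≈d = begin
    V (k + t)               ≡⟨ cong (_mod n) (trans (*-distribʳ-+ e k t) (+-comm (k * e) (t * e))) ⟩
    (t * e + k * e) mod n   ≡⟨ mod-⊕ (t * e) (k * e) ⟨
    V t ⊕ k * e             ≡⟨ ⊕-cong (V t) ke≈d ⟩
    V t ⊕ d                 ∎
    where open ≡-Reasoning

  arc+2 : ∀ t → G (V t) (V (2 + t))
  arc+2 t = inj₂ (subst (λ w → diffMod n w (V t) ≡ c) (sym (V-step 2 t 2*e≈c))
                        (diffMod-⊕ (V t) c<n))

  arc+3 : ∀ t → G (V t) (V (3 + t))
  arc+3 t = inj₁ (subst (λ w → diffMod n w (V t) ≡ 1) (sym (V-step 3 t 3*e≈1))
                        (diffMod-⊕ (V t) 1<n))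

  module Walks (X : Subset n) (isolated : ∀ t → V t ∈ X → ¬ V (suc t) ∈ X) (u : Fin n) =
    ForwardWalks (λ t → V t ∈ X) (λ t → V t ∈? X) isolated (λ t → PathIn G (∁ X) u (V t))
                 (λ {t} reached free → pathIn-snoc reached (arc+2 t) (x∉p⇒x∈∁p free))
                 (λ {t} reached free → pathIn-snoc reached (arc+3 t) (x∉p⇒x∈∁p free))

  stronglyConnected : ∀ X → (∀ t → V t ∈ X → ¬ V (suc t) ∈ X) →
                      (∀ s → ¬ (V (2 + s) ∈ X × V (5 + s) ∈ X × V (8 + s) ∈ X)) →
                      StronglyConnected G (∁ X)
  stronglyConnected X isolated not-all u v u∈ v∈ = reach-v covered-eventually
    where
    open Walks X isolated u
    covered-eventually : ∃[ q ] (∀ t → q ≤ t → Covered t)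
    covered-eventually = eventually-covered {3 * toℕ u}
      (subst (PathIn G (∁ X) u) (sym (V-3* u)) (here u∈)) (not-all (3 * toℕ u))
    reach-v : ∃[ q ] (∀ t → q ≤ t → Covered t) → PathIn G (∁ X) u v
    reach-v (q , covered) = subst (PathIn G (∁ X) u) V-target≡v (covered target q≤target v∉X)
      where
      target = 3 * toℕ v + q * n
      q≤target = ≤-trans (m≤m*n q n) (m≤n+m (q * n) (3 * toℕ v))
      V-target≡v = trans (V-periodic (3 * toℕ v) q) (V-3* v)
      v∉X = x∈∁p⇒x∉p (subst (_∈ ∁ X) (sym V-target≡v) v∈)

  consecutive : Fin n → Subset n
  consecutive i = pair (V (toℕ i)) (V (suc (toℕ i)))

  consecutivePairs : List (Subset n)
  consecutivePairs = map consecutive (allFin n)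

  good-or-consecutive : ∀ X → ∣ X ∣ ≡ 2 → Good G 2 X ⊎ X ∈ₗ consecutivePairs
  good-or-consecutive X ∣X∣≡2 with any? (λ i → (V (toℕ i) ∈? X) ×-dec (V (suc (toℕ i)) ∈? X))
  ... | yes (i , x∈X , y∈X) =
    inj₂ (subst (_∈ₗ consecutivePairs) (sym (∣p∣≡2⇒p≡pair ∣X∣≡2 (V-distinct 1 (toℕ i) n∤1) x∈X y∈X))
                (∈-map⁺ consecutive (∈-allFin i)))
    where n∤1 = <⇒≢ 1<n ∘ sym ∘ ∣1⇒≡1
  ... | no none = inj₁ (∣X∣≡2 , stronglyConnected X isolated not-all)
    where
    isolated : ∀ t → V t ∈ X → ¬ V (suc t) ∈ X
    isolated t x∈X y∈X = none (t mod n , subst (_∈ X) (V-cong (sym (toℕ-mod≈ t))) x∈X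
                                       , subst (_∈ X) (V-cong (≈-+ {1} refl (sym (toℕ-mod≈ t)))) y∈X)
    not-all : ∀ s → ¬ (V (2 + s) ∈ X × V (5 + s) ∈ X × V (8 + s) ∈ X)
    not-all s (x∈X , y∈X , z∈X) =
      ∣p∣≡2⇒¬three ∣X∣≡2 (V-distinct 3 (2 + s) n∤3) (V-distinct 3 (5 + s) n∤3)
                   (V-distinct 6 (2 + s) n∤6) x∈X y∈X z∈X

module OutNeighbours (n : ℕ) .{{_ : NonZero n}} (half : ℕ) (half*2≈1 : half * 2 ≈ 1 [mod n ])
                     (3<n : 3 < n) (a b : ℕ) (a<n : a < n) (b<n : b < n)
                     (a≢0 : a ≢ 0) (b≢0 : b ≢ 0) (a≢b : a ≢ b) where
  open Residues n

  H : Digraph n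
  H = Circulant n a b

  outNeighbours : Fin n → Subset n
  outNeighbours v = pair (v ⊕ a) (v ⊕ b)

  ∣outNeighbours∣≡2 : ∀ v → ∣ outNeighbours v ∣ ≡ 2
  ∣outNeighbours∣≡2 v = ∣pair∣≡2 (a≢b ∘ ⊕-cancelˡ v a<n b<n)

  arc⇒∈outNeighbours : ∀ {v w} → H v w → w ∈ outNeighbours v
  arc⇒∈outNeighbours (inj₁ diff≡a) = subst (_∈ outNeighbours _) (sym (diffMod≡⇒≡⊕ diff≡a)) (x∈pair _ _)
  arc⇒∈outNeighbours (inj₂ diff≡b) = subst (_∈ outNeighbours _) (sym (diffMod≡⇒≡⊕ diff≡b)) (y∈pair _ _)

  ∉outNeighbours : ∀ v → v ∉ outNeighbours v
  ∉outNeighbours v v∈out with ∈pair⁻ (subst (_∈ outNeighbours v) (sym (⊕-identityʳ v)) v∈out)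
  ... | inj₁ v≡v+a = a≢0 (sym (⊕-cancelˡ v (≤-trans (s≤s z≤n) 3<n) a<n v≡v+a))
  ... | inj₂ v≡v+b = b≢0 (sym (⊕-cancelˡ v (≤-trans (s≤s z≤n) 3<n) b<n v≡v+b))

  sink : ∀ {v w} → PathIn H (∁ (outNeighbours v)) v w → w ≡ v
  sink (here _)        = refl
  sink (step _ v→x x⇝w) = contradiction (arc⇒∈outNeighbours v→x) (x∈∁p⇒x∉p (pathIn-source∈ x⇝w))

  ¬stronglyConnected : ∀ v → ¬ StronglyConnected H (∁ (outNeighbours v))
  ¬stronglyConnected v sc = <⇒≱ (s≤s (s≤s z≤n)) (begin
    2                            ≤⟨ ∸-monoˡ-≤ 2 3<n ⟩
    n ∸ 2                        ≡⟨ cong (n ∸_) (∣outNeighbours∣≡2 v) ⟨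
    n ∸ ∣ outNeighbours v ∣      ≡⟨ ∣∁p∣≡n∸∣p∣ (outNeighbours v) ⟨
    ∣ ∁ (outNeighbours v) ∣      ≤⟨ p⊆q⇒∣p∣≤∣q∣ only-v ⟩
    ∣ ⁅ v ⁆ ∣                    ≡⟨ ∣⁅x⁆∣≡1 v ⟩
    1                            ∎)
    where
    open ≤-Reasoning
    only-v : ∁ (outNeighbours v) ⊆ ⁅ v ⁆
    only-v {w} w∈ = subst (_∈ ⁅ v ⁆) (sym (sink (sc v w v∈ w∈))) (x∈⁅x⁆ v)
      where v∈ = x∉p⇒x∈∁p (∉outNeighbours v)

  outNeighbours-injective : ∀ {v w} → outNeighbours v ≡ outNeighbours w → v ≡ w
  outNeighbours-injective {v} {w} eq
    with ∈pair⁻ (subst (v ⊕ a ∈_) eq (x∈pair _ _)) | ∈pair⁻ (subst (v ⊕ b ∈_) eq (y∈pair _ _))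
  ... | inj₁ v+a≡w+a | _            = ⊕-cancelʳ a v+a≡w+a
  ... | _            | inj₂ v+b≡w+b = ⊕-cancelʳ b v+b≡w+b
  ... | inj₂ v+a≡w+b | inj₁ v+b≡w+a =
    toℕ-≈-injective (≈-cancelʳ-* {2} {half} (toℕ v) (toℕ w) half*2≈1 (≈-cancelʳ-+ (a + b) (begin
      (toℕ v * 2 + (a + b)) % n          ≡⟨ cong (_% n) (rearrange (toℕ v) a b) ⟩
      ((toℕ v + a) + (toℕ v + b)) % n    ≡⟨ ≈-+ (mod-injective v+a≡w+b) (mod-injective v+b≡w+a) ⟩
      ((toℕ w + b) + (toℕ w + a)) % n    ≡⟨ cong (_% n) (rearrange (toℕ w) b a) ⟨
      (toℕ w * 2 + (b + a)) % n          ≡⟨ cong (λ s → (toℕ w * 2 + s) % n) (+-comm b a) ⟩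
      (toℕ w * 2 + (a + b)) % n          ∎)))
    where
    open ≡-Reasoning
    rearrange : ∀ x a b → x * 2 + (a + b) ≡ (x + a) + (x + b)
    rearrange = solve-∀

  outNeighbourSets : List (Subset n)
  outNeighbourSets = map outNeighbours (allFin n)

  outNeighbourSets-unique : Unique outNeighbourSets
  outNeighbourSets-unique = map⁺ outNeighbours-injective (allFin⁺ n)

  ∈outNeighbourSets⇒lost : ∀ {X} → X ∈ₗ outNeighbourSets →
                           ∣ X ∣ ≡ 2 × ¬ StronglyConnected H (∁ X)
  ∈outNeighbourSets⇒lost X∈ with v , _ , refl ← ∈-map⁻ outNeighbours X∈ =
    ∣outNeighbours∣≡2 v , ¬stronglyConnected v

mainTheorem7 : (n : ℕ) → 5 ≤ n → ¬ (2 ∣ n) → ¬ (3 ∣ n)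
    → (c : ℕ) → c < n → (∃[ q ] (3 * c ≡ 2 + q * n))
    → (a b : ℕ) → a < n → b < n → a ≢ 0 → b ≢ 0 → a ≢ b → Generates n a b
    → (kG kH : ℕ) → IsF (Circulant n 1 c) 2 kG → IsF (Circulant n a b) 2 kH
    → kH ≤ kG
mainTheorem7 n 5≤n 2∤n _ c c<n (q , 3c≡2+qn) a b a<n b<n a≢0 b≢0 a≢b _ kG kH isFG isFH =
  IsF-≤ outNeighbourSets consecutivePairs isFG isFH
        outNeighbourSets-unique ∈outNeighbourSets⇒lost good-or-consecutive
        (≤-reflexive (trans (length-map-allFin consecutive)
                            (sym (length-map-allFin outNeighbours))))
  where
  instance _ = >-nonZero (≤-trans (s≤s z≤n) 5≤n)
  open Residues n

  3<n : 3 < n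
  3<n = ≤-trans (n≤1+n 4) 5≤n

  half : ℕ
  half = 1 + n / 2

  half*2≈1 : half * 2 ≈ 1 [mod n ]
  half*2≈1 = odd⇒[1+n/2]*2≈1 2∤n

  3c≈2 : 3 * c ≈ 2 [mod n ]
  3c≈2 = trans (cong (_% n) 3c≡2+qn) (m+kn≈m 2 q)

  open OutNeighbours n half half*2≈1 3<n a b a<n b<n a≢0 b≢0 a≢b
  open Relabelled n c (c * half) (≤-trans (s≤s (s≤s z≤n)) 3<n) c<n
                  (3*[c*w]≈1 {c} 3c≈2 half*2≈1) (2*[c*w]≈c c half*2≈1)
                  (<⇒≱ 3<n ∘ ∣⇒≤) (odd⇒∤6 5≤n 2∤n)
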